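{- For all integers $1\le k<t$, $C^*_t(k)\le\binom{t-1}{k}2^k$.
   Context: For integers $N\ge\omega\ge1$, the Turán graph $T(N,\omega)$ is the complete $\omega$-partite graph on $N$ vertices with part sizes $\lfloor N/\omega\rfloor$ or $\lceil N/\omega\rceil$. For integers $1\le k<t$, $T^*_t(k)$ is the Turán graph $T(2t-\omega-1,\omega)$ maximizing the number of cliques of order $k$ among all $\omega$ with $k\le\omega\le t-1$, and $C^*_t(k)$ is the number of cliques of order $k$ in $T^*_t(k)$. -}

module Defs where

open import Data.Nat using (ℕ; zero; suc; _+_; _*_; _∸_; _⊔_; NonZero; _≡ᵇ_)
open import Data.Nat.DivMod using (_%_)

open import Data.Bool using (Bool; true; false; _∧_; _∨_; not; if_then_else_)
open import Data.Fin using (Fin; toℕ)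
open import Data.Fin.Properties using () renaming (_≟_ to _≟ᶠ_)
open import Data.Fin.Subset using (Subset; ∣_∣)
open import Data.Bool.ListAction using (and)
open import Data.Vec using (Vec; []; _∷_; lookup)
open import Data.List using (List; []; _∷_; _++_; map; foldr; allFin; upTo; length; filterᵇ)
open import Relation.Nullary.Decidable using (⌊_⌋)
open import Data.Nat.Properties using ()

allSubsets : (n : ℕ) → List (Subset n)
allSubsets zero    = [] ∷ []
allSubsets (suc n) = map (true ∷_) (allSubsets n) ++ map (false ∷_) (allSubsets n)

-- Turán graph T(N, ω) for ω ≥ 1 on vertex set Fin N: vertex i lies in part
-- (i mod ω); parts are the ω residue classes, whose sizes are ⌊N/ω⌋ or ⌈N/ω⌉.
turánAdj : (N ω : ℕ) → .{{NonZero ω}} → Fin N → Fin N → Bool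
turánAdj N ω i j = not ((toℕ i % ω) ≡ᵇ (toℕ j % ω))

isTuránClique : (N ω : ℕ) → .{{NonZero ω}} → Subset N → Bool
isTuránClique N ω S =
  and (map (λ i → and (map (λ j →
        not (lookup S i ∧ lookup S j ∧ not ⌊ i ≟ᶠ j ⌋) ∨ turánAdj N ω i j)
      (allFin N))) (allFin N))

-- Number of cliques of order k in T(N, ω) (number of k-vertex cliques).
-- The case ω = 0 (no Turán graph) is never used below; it is set to 0.
turánCliques : (N ω k : ℕ) → ℕ
turánCliques N zero    k = 0
turánCliques N (suc w) k =
  length (filterᵇ (λ S → (∣ S ∣ ≡ᵇ k) ∧ isTuránClique N (suc w) S) (allSubsets N))

maxList : List ℕ → ℕ
maxList = foldr _⊔_ 0

-- C*_t(k) = max over k ≤ ω ≤ t-1 of the number of k-cliques of T(2t-ω-1, ω).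
Cstar : (t k : ℕ) → ℕ
Cstar t k = maxList (map (λ ω → turánCliques (2 * t ∸ ω ∸ 1) ω k)
                         (map (λ i → k + i) (upTo (t ∸ k))))

-- Colour the vertices of T(N, ω) by their parts and split every colour class of size a into
-- ⌊a/2⌋ pairs and a mod 2 singletons.  The k-cliques of the complete multipartite graph with
-- these colour classes are at most those of the complete multipartite graph K whose parts are the
-- pairs and singletons: induct on the vertices of a partial colouring, where the cliques through
-- a vertex of colour x are the cliques of the others with colour x deleted, and compare with the
-- recursion for the clique count of K.  K has s = Σ ⌈a/2⌉ ≤ (N + ω)/2 parts, each of size at most
-- 2, so it has at most C(s, k) 2^k cliques of order k; for N = 2t - ω - 1 this gives s ≤ t - 1.

module Submission where

open import Defs
open import Data.Bool using (Bool; true; false; _∧_; _∨_; not; if_then_else_; T)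
open import Data.Bool.ListAction using (all)
open import Data.Bool.Properties using (T-∧)
open import Data.Empty using (⊥-elim)
open import Data.Fin using (Fin; zero; suc; toℕ)
open import Data.Fin.Properties using () renaming (_≟_ to _≟ᶠ_; suc-injective to Fin-suc-injective)
open import Data.Fin.Subset using (Subset; ∣_∣)
open import Data.List using (List; []; _∷_; _++_; map; length; filterᵇ; allFin)
open import Data.List.Properties using (filter-++; filter-none; length-++; foldr-preservesᵇ)
open import Data.List.Relation.Unary.All using (universal)
open import Data.List.Relation.Unary.All.Properties using (all⁺; all⁻; tabulate⁺; tabulate⁻; map⁺; applyUpTo⁺₁)
open import Data.Maybe using (Maybe; just; nothing; is-just)
open import Data.Nat
open import Data.Nat.Combinatorics using (_C_; nCk+nC[k+1]≡[n+1]C[k+1])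
open import Data.Nat.DivMod using (m%n<n)
open import Data.Nat.Properties
open import Data.Nat.Tactic.RingSolver using (solve-∀)
open import Algebra.Properties.CommutativeSemigroup +-commutativeSemigroup using (interchange; xy∙z≈xz∙y)
open import Data.Product using (_,_; proj₂)
open import Data.Vec using (_∷_; lookup)
open import Function using (_∘_; id)
open import Function.Bundles using (Equivalence)
open import Relation.Nullary using (¬_; yes; no)
open import Relation.Nullary.Decidable using (⌊_⌋; fromWitnessFalse; toWitnessFalse)
open import Relation.Nullary.Decidable.Core using (T?)
open import Relation.Binary.PropositionalEquality

private
  variable
    A B : Set
    n w x k : ℕ

count : (A → Bool) → List A → ℕ
count p xs = length (filterᵇ p xs)

count-++ : ∀ (p : A → Bool) xs ys → count p (xs ++ ys) ≡ count p xs + count p ys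
count-++ p xs ys = trans (cong length (filter-++ (T? ∘ p) xs ys)) (length-++ (filterᵇ p xs))

count-map : ∀ (p : B → Bool) (f : A → B) xs → count p (map f xs) ≡ count (p ∘ f) xs
count-map p f [] = refl
count-map p f (x ∷ xs) with p (f x)
... | true  = cong suc (count-map p f xs)
... | false = count-map p f xs

count-none : ∀ {p : A → Bool} → (∀ x → ¬ T (p x)) → ∀ xs → count p xs ≡ 0
count-none {p = p} ¬p xs = cong length (filter-none (T? ∘ p) (universal ¬p xs))

count-∧-mono : ∀ {p q r : A → Bool} → (∀ x → T (q x) → T (r x)) →
               ∀ xs → count (λ x → p x ∧ q x) xs ≤ count (λ x → p x ∧ r x) xs
count-∧-mono q⇒r [] = z≤n
count-∧-mono {p = p} {q} {r} q⇒r (x ∷ xs) with p x | q x in qx | r x in rx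
... | false | _     | _     = count-∧-mono q⇒r xs
... | true  | false | false = count-∧-mono q⇒r xs
... | true  | false | true  = m≤n⇒m≤1+n (count-∧-mono q⇒r xs)
... | true  | true  | true  = s≤s (count-∧-mono q⇒r xs)
... | true  | true  | false with () ← subst T rx (q⇒r x (subst T (sym qx) _))

-- isTuránClique N ω unfolds to isCliqueᵇ (turánAdj N ω).
isCliqueᵇ : (Fin n → Fin n → Bool) → Subset n → Bool
isCliqueᵇ {n} adj S =
  all (λ i → all (λ j → not (lookup S i ∧ lookup S j ∧ not ⌊ i ≟ᶠ j ⌋) ∨ adj i j) (allFin n)) (allFin n)

IsClique : (Fin n → Fin n → Bool) → Subset n → Set
IsClique adj S = ∀ i j → T (lookup S i) → T (lookup S j) → i ≢ j → T (adj i j)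

T-not-∨⁻ : ∀ a b → T (not a ∨ b) → T a → T b
T-not-∨⁻ true b h _ = h

T-not-∨⁺ : ∀ a b → (T a → T b) → T (not a ∨ b)
T-not-∨⁺ false b h = _
T-not-∨⁺ true  b h = h _

isCliqueᵇ-sound : ∀ (adj : Fin n → Fin n → Bool) S → T (isCliqueᵇ adj S) → IsClique adj S
isCliqueᵇ-sound adj S h i j i∈S j∈S i≢j with lookup S i | lookup S j
                                          | tabulate⁻ (all⁺ _ _ (tabulate⁻ (all⁺ _ _ h) i)) j
... | true | true | entry = T-not-∨⁻ (not ⌊ i ≟ᶠ j ⌋) (adj i j) entry (fromWitnessFalse i≢j)

isCliqueᵇ-complete : ∀ (adj : Fin n → Fin n → Bool) S → IsClique adj S → T (isCliqueᵇ adj S)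
isCliqueᵇ-complete adj S clique = all⁻ _ (tabulate⁺ λ i → all⁻ _ (tabulate⁺ λ j → entry i j))
  where
  entry : ∀ i j → T (not (lookup S i ∧ lookup S j ∧ not ⌊ i ≟ᶠ j ⌋) ∨ adj i j)
  entry i j with lookup S i in si | lookup S j in sj
  ... | false | _     = _
  ... | true  | false = _
  ... | true  | true  = T-not-∨⁺ (not ⌊ i ≟ᶠ j ⌋) (adj i j) λ i≢j →
    clique i j (subst T (sym si) _) (subst T (sym sj) _) (toWitnessFalse i≢j)

-- Vertices coloured `nothing` are deleted; the colour classes of the others are the parts of a
-- complete multipartite graph.
PartialColouring : ℕ → Set
PartialColouring n = Fin n → Maybe ℕ

tail : PartialColouring (suc n) → PartialColouring n
tail c = c ∘ suc

differentColours : Maybe ℕ → Maybe ℕ → Bool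
differentColours (just a) (just b) = not (a ≡ᵇ b)
differentColours _        _        = false

isColourCliqueᵇ : PartialColouring n → Subset n → Bool
isColourCliqueᵇ {n} c S =
  isCliqueᵇ (λ i j → differentColours (c i) (c j)) S ∧ all (λ i → not (lookup S i) ∨ is-just (c i)) (allFin n)

record IsColourClique (c : PartialColouring n) (S : Subset n) : Set where
  field
    coloured : ∀ i → T (lookup S i) → T (is-just (c i))
    clique   : IsClique (λ i j → differentColours (c i) (c j)) S
open IsColourClique

isColourCliqueᵇ-sound : ∀ (c : PartialColouring n) S → T (isColourCliqueᵇ c S) → IsColourClique c S
isColourCliqueᵇ-sound c S h with cliqueᵇ , colouredᵇ ← Equivalence.to T-∧ h = record
  { coloured = λ i → T-not-∨⁻ (lookup S i) (is-just (c i)) (tabulate⁻ (all⁺ _ _ colouredᵇ) i)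
  ; clique   = isCliqueᵇ-sound _ S cliqueᵇ
  }

isColourCliqueᵇ-complete : ∀ (c : PartialColouring n) S → IsColourClique c S → T (isColourCliqueᵇ c S)
isColourCliqueᵇ-complete c S cc = Equivalence.from T-∧
  ( isCliqueᵇ-complete _ S (clique cc)
  , all⁻ _ (tabulate⁺ λ i → T-not-∨⁺ (lookup S i) (is-just (c i)) (coloured cc i)) )

IsColourClique-tail : ∀ (c : PartialColouring (suc n)) S →
                      IsColourClique c (false ∷ S) → IsColourClique (tail c) S
IsColourClique-tail c S cc = record
  { coloured = λ i → coloured cc (suc i)
  ; clique   = λ i j i∈S j∈S i≢j → clique cc (suc i) (suc j) i∈S j∈S (i≢j ∘ Fin-suc-injective)
  }

uncolour : ℕ → Maybe ℕ → Maybe ℕ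
uncolour x nothing  = nothing
uncolour x (just y) = if x ≡ᵇ y then nothing else just y

removeColour : ℕ → PartialColouring n → PartialColouring n
removeColour x c = uncolour x ∘ c

uncolour-different : ∀ x u → T (differentColours (just x) u) → uncolour x u ≡ u
uncolour-different x (just y) h with x ≡ᵇ y
... | false = refl

IsColourClique-removeColour : ∀ (c : PartialColouring (suc n)) S → c zero ≡ just x →
  IsColourClique c (true ∷ S) → IsColourClique (removeColour x (tail c)) S
IsColourClique-removeColour {x = x} c S c₀≡x cc = record
  { coloured = λ i i∈S → subst (T ∘ is-just) (sym (unchanged i i∈S)) (coloured cc (suc i) i∈S)
  ; clique   = λ i j i∈S j∈S i≢j → subst₂ (λ u v → T (differentColours u v))
      (sym (unchanged i i∈S)) (sym (unchanged j j∈S)) (clique cc (suc i) (suc j) i∈S j∈S (i≢j ∘ Fin-suc-injective))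
  }
  where
  unchanged : ∀ i → T (lookup S i) → uncolour x (c (suc i)) ≡ c (suc i)
  unchanged i i∈S = uncolour-different x (c (suc i))
    (subst (λ u → T (differentColours u (c (suc i)))) c₀≡x (clique cc zero (suc i) _ i∈S λ ()))

¬IsColourClique-uncoloured : ∀ (c : PartialColouring (suc n)) S → c zero ≡ nothing →
                             ¬ IsColourClique c (true ∷ S)
¬IsColourClique-uncoloured c S c₀≡nothing cc = subst (T ∘ is-just) c₀≡nothing (coloured cc zero _)

cliqueCount : PartialColouring n → ℕ → ℕ
cliqueCount {n} c k = count (λ S → (∣ S ∣ ≡ᵇ k) ∧ isColourCliqueᵇ c S) (allSubsets n)

cliquesThrough₀ : PartialColouring (suc n) → ℕ → ℕ
cliquesThrough₀ {n} c k = count (λ S → (suc ∣ S ∣ ≡ᵇ k) ∧ isColourCliqueᵇ c (true ∷ S)) (allSubsets n)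

cliqueCount-suc : ∀ (c : PartialColouring (suc n)) k →
                  cliqueCount c k ≤ cliquesThrough₀ c k + cliqueCount (tail c) k
cliqueCount-suc {n} c k = begin
  cliqueCount c k
    ≡⟨ count-++ _ (map (true ∷_) (allSubsets n)) (map (false ∷_) (allSubsets n)) ⟩
  count sized (map (true ∷_) (allSubsets n)) + count sized (map (false ∷_) (allSubsets n))
    ≡⟨ cong₂ _+_ (count-map sized (true ∷_) (allSubsets n)) (count-map sized (false ∷_) (allSubsets n)) ⟩
  cliquesThrough₀ c k + count (sized ∘ (false ∷_)) (allSubsets n)
    ≤⟨ +-monoʳ-≤ (cliquesThrough₀ c k) (count-∧-mono {p = λ S → ∣ S ∣ ≡ᵇ k} avoids₀ (allSubsets n)) ⟩
  cliquesThrough₀ c k + cliqueCount (tail c) k ∎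
  where
  open ≤-Reasoning
  sized : Subset (suc n) → Bool
  sized S = (∣ S ∣ ≡ᵇ k) ∧ isColourCliqueᵇ c S
  avoids₀ : ∀ S → T (isColourCliqueᵇ c (false ∷ S)) → T (isColourCliqueᵇ (tail c) S)
  avoids₀ S = isColourCliqueᵇ-complete (tail c) S ∘ IsColourClique-tail c S ∘ isColourCliqueᵇ-sound c (false ∷ S)

cliquesThrough₀-zero : ∀ (c : PartialColouring (suc n)) → cliquesThrough₀ c 0 ≡ 0
cliquesThrough₀-zero {n} c = count-none (λ S ()) (allSubsets n)

cliquesThrough₀-uncoloured : ∀ (c : PartialColouring (suc n)) k → c zero ≡ nothing → cliquesThrough₀ c k ≡ 0
cliquesThrough₀-uncoloured {n} c k c₀≡nothing = count-none none (allSubsets n)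
  where
  none : ∀ S → ¬ T ((suc ∣ S ∣ ≡ᵇ k) ∧ isColourCliqueᵇ c (true ∷ S))
  none S h = ¬IsColourClique-uncoloured c S c₀≡nothing
    (isColourCliqueᵇ-sound c (true ∷ S) (proj₂ (Equivalence.to (T-∧ {suc ∣ S ∣ ≡ᵇ k}) h)))

cliquesThrough₀-coloured : ∀ (c : PartialColouring (suc n)) k → c zero ≡ just x →
                           cliquesThrough₀ c (suc k) ≤ cliqueCount (removeColour x (tail c)) k
cliquesThrough₀-coloured {n} c k c₀≡x = count-∧-mono {p = λ S → ∣ S ∣ ≡ᵇ k} through₀ (allSubsets n)
  where
  through₀ : ∀ S → T (isColourCliqueᵇ c (true ∷ S)) → T (isColourCliqueᵇ (removeColour _ (tail c)) S)
  through₀ S = isColourCliqueᵇ-complete _ S ∘ IsColourClique-removeColour c S c₀≡x ∘ isColourCliqueᵇ-sound c (true ∷ S)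

-- The number of k-cliques of the complete multipartite graph with p parts of size 2 and q parts
-- of size 1 (recursion on the parts of size 2).
cliques₂₁ : ℕ → ℕ → ℕ → ℕ
cliques₂₁ p       q zero    = 1
cliques₂₁ zero    q (suc k) = q C suc k
cliques₂₁ (suc p) q (suc k) = cliques₂₁ p q (suc k) + 2 * cliques₂₁ p q k

cliques₂₁-single : ∀ p q k → cliques₂₁ p (suc q) (suc k) ≡ cliques₂₁ p q (suc k) + cliques₂₁ p q k
cliques₂₁-single zero    q zero    = trans (sym (nCk+nC[k+1]≡[n+1]C[k+1] q 0)) (+-comm 1 _)
cliques₂₁-single zero    q (suc k) = trans (sym (nCk+nC[k+1]≡[n+1]C[k+1] q (suc k))) (+-comm (q C suc k) _)
cliques₂₁-single (suc p) q zero    =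
  trans (cong (_+ 2) (cliques₂₁-single p q zero)) (xy∙z≈xz∙y (cliques₂₁ p q 1) 1 2)
cliques₂₁-single (suc p) q (suc k) = begin
  cliques₂₁ p (suc q) (suc (suc k)) + 2 * cliques₂₁ p (suc q) (suc k)
    ≡⟨ cong₂ (λ a b → a + 2 * b) (cliques₂₁-single p q (suc k)) (cliques₂₁-single p q k) ⟩
  (cliques₂₁ p q (suc (suc k)) + cliques₂₁ p q (suc k)) + 2 * (cliques₂₁ p q (suc k) + cliques₂₁ p q k)
    ≡⟨ regroup (cliques₂₁ p q (suc (suc k))) (cliques₂₁ p q (suc k)) (cliques₂₁ p q k) ⟩
  (cliques₂₁ p q (suc (suc k)) + 2 * cliques₂₁ p q (suc k)) + (cliques₂₁ p q (suc k) + 2 * cliques₂₁ p q k) ∎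
  where
  open ≡-Reasoning
  regroup : ∀ a b c → (a + b) + 2 * (b + c) ≡ (a + 2 * b) + (b + 2 * c)
  regroup = solve-∀

cliques₂₁-pair : ∀ p q k → cliques₂₁ p q k + cliques₂₁ p (suc q) (suc k) ≡ cliques₂₁ (suc p) q (suc k)
cliques₂₁-pair p q k = begin
  cliques₂₁ p q k + cliques₂₁ p (suc q) (suc k)                 ≡⟨ cong (cliques₂₁ p q k +_) (cliques₂₁-single p q k) ⟩
  cliques₂₁ p q k + (cliques₂₁ p q (suc k) + cliques₂₁ p q k)   ≡⟨ regroup (cliques₂₁ p q k) (cliques₂₁ p q (suc k)) ⟩
  cliques₂₁ p q (suc k) + 2 * cliques₂₁ p q k                   ∎
  where
  open ≡-Reasoning
  regroup : ∀ a b → a + (b + a) ≡ b + 2 * a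
  regroup = solve-∀

cliques₂₁-≤-suc : ∀ p q k → cliques₂₁ p q k ≤ cliques₂₁ (suc p) q k
cliques₂₁-≤-suc p q zero    = ≤-refl
cliques₂₁-≤-suc p q (suc k) = m≤m+n (cliques₂₁ p q (suc k)) _

-- p and q count the pairs and singletons of all colour classes but one, of size a; a new vertex
-- joining that class turns its ⌊ a /2⌋ pairs and a % 2 singletons into ⌊ suc a /2⌋ and suc a % 2.
cliques₂₁-grow : ∀ p q a k →
  cliques₂₁ p q k + cliques₂₁ (p + ⌊ a /2⌋) (q + a % 2) (suc k)
    ≤ cliques₂₁ (p + ⌊ suc a /2⌋) (q + suc a % 2) (suc k)
cliques₂₁-grow p q zero k rewrite +-identityʳ p | +-identityʳ q | +-comm q 1 =
  ≤-reflexive (trans (+-comm (cliques₂₁ p q k) _) (sym (cliques₂₁-single p q k)))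
cliques₂₁-grow p q (suc zero) k rewrite +-identityʳ p | +-identityʳ q | +-comm p 1 | +-comm q 1 =
  ≤-reflexive (cliques₂₁-pair p q k)
cliques₂₁-grow p q (suc (suc a)) k rewrite +-suc p ⌊ a /2⌋ | +-suc p ⌊ suc a /2⌋ =
  ≤-trans (+-monoˡ-≤ _ (cliques₂₁-≤-suc p q k)) (cliques₂₁-grow (suc p) q a k)

cliques₂₁≤ : ∀ p q k → cliques₂₁ p q k ≤ ((p + q) C k) * 2 ^ k
cliques₂₁≤ p       q zero    = ≤-refl
cliques₂₁≤ zero    q (suc k) = begin
  q C suc k           ≡⟨ *-identityʳ (q C suc k) ⟨
  (q C suc k) * 1     ≤⟨ *-monoʳ-≤ (q C suc k) (m^n>0 2 (suc k)) ⟩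
  (q C suc k) * 2 ^ suc k ∎
  where open ≤-Reasoning
cliques₂₁≤ (suc p) q (suc k) = begin
  cliques₂₁ p q (suc k) + 2 * cliques₂₁ p q k
    ≤⟨ +-mono-≤ (cliques₂₁≤ p q (suc k)) (*-monoʳ-≤ 2 (cliques₂₁≤ p q k)) ⟩
  (m C suc k) * 2 ^ suc k + 2 * ((m C k) * 2 ^ k)
    ≡⟨ regroup (m C suc k) (m C k) (2 ^ k) ⟩
  (m C k + m C suc k) * 2 ^ suc k
    ≡⟨ cong (_* 2 ^ suc k) (nCk+nC[k+1]≡[n+1]C[k+1] m k) ⟩
  (suc m C suc k) * 2 ^ suc k ∎
  where
  open ≤-Reasoning
  m = p + q
  regroup : ∀ a b e → a * (2 * e) + 2 * (b * e) ≡ (b + a) * (2 * e)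
  regroup = solve-∀

C-≤-suc : ∀ n k → n C k ≤ suc n C k
C-≤-suc n zero    = ≤-refl
C-≤-suc n (suc k) = ≤-trans (m≤n+m (n C suc k) (n C k)) (≤-reflexive (nCk+nC[k+1]≡[n+1]C[k+1] n k))

C-monoˡ : ∀ {m n} k → m ≤ n → m C k ≤ n C k
C-monoˡ k m≤n = go (≤⇒≤′ m≤n)
  where
  go : ∀ {m n} → m ≤′ n → m C k ≤ n C k
  go ≤′-refl        = ≤-refl
  go (≤′-step m≤′n) = ≤-trans (go m≤′n) (C-≤-suc _ k)

sumBelow : ℕ → (ℕ → ℕ) → ℕ
sumBelow zero    f = 0
sumBelow (suc w) f = sumBelow w f + f w

sumBelow-cong : ∀ w {f g : ℕ → ℕ} → (∀ r → r < w → f r ≡ g r) → sumBelow w f ≡ sumBelow w g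
sumBelow-cong zero    f≗g = refl
sumBelow-cong (suc w) f≗g = cong₂ _+_ (sumBelow-cong w λ r r<w → f≗g r (m<n⇒m<1+n r<w)) (f≗g w ≤-refl)

sumBelow-mono : ∀ w {f g : ℕ → ℕ} → (∀ r → f r ≤ g r) → sumBelow w f ≤ sumBelow w g
sumBelow-mono zero    f≤g = z≤n
sumBelow-mono (suc w) f≤g = +-mono-≤ (sumBelow-mono w f≤g) (f≤g w)

sumBelow-+ : ∀ w (f g : ℕ → ℕ) → sumBelow w (λ r → f r + g r) ≡ sumBelow w f + sumBelow w g
sumBelow-+ zero    f g = refl
sumBelow-+ (suc w) f g =
  trans (cong (_+ (f w + g w)) (sumBelow-+ w f g)) (interchange (sumBelow w f) (sumBelow w g) (f w) (g w))

sumBelow-*ˡ : ∀ m w (f : ℕ → ℕ) → sumBelow w (λ r → m * f r) ≡ m * sumBelow w f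
sumBelow-*ˡ m zero    f = sym (*-zeroʳ m)
sumBelow-*ˡ m (suc w) f = trans (cong (_+ m * f w) (sumBelow-*ˡ m w f)) (sym (*-distribˡ-+ m (sumBelow w f) (f w)))

sumBelow-zero : ∀ w → sumBelow w (λ _ → 0) ≡ 0
sumBelow-zero zero    = refl
sumBelow-zero (suc w) = cong (_+ 0) (sumBelow-zero w)

sumBelow-one : ∀ w → sumBelow w (λ _ → 1) ≡ w
sumBelow-one zero    = refl
sumBelow-one (suc w) = trans (cong (_+ 1) (sumBelow-one w)) (+-comm w 1)

sumBelow-split : ∀ {w x} {f g : ℕ → ℕ} → x < w → g x ≡ 0 → (∀ r → r ≢ x → f r ≡ g r) →
                 sumBelow w f ≡ sumBelow w g + f x
sumBelow-split {suc w} {x} {f} {g} x<w gx≡0 f≗g with x ≟ w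
... | yes refl = cong (_+ f x) (begin
  sumBelow w f       ≡⟨ sumBelow-cong w (λ r r<w → f≗g r (<⇒≢ r<w)) ⟩
  sumBelow w g       ≡⟨ +-identityʳ (sumBelow w g) ⟨
  sumBelow w g + 0   ≡⟨ cong (sumBelow w g +_) gx≡0 ⟨
  sumBelow w g + g x ∎)
  where open ≡-Reasoning
... | no x≢w = begin
  sumBelow w f + f w         ≡⟨ cong₂ _+_ (sumBelow-split (≤∧≢⇒< (≤-pred x<w) x≢w) gx≡0 f≗g) (f≗g w (x≢w ∘ sym)) ⟩
  sumBelow w g + f x + g w   ≡⟨ xy∙z≈xz∙y (sumBelow w g) (f x) (g w) ⟩
  sumBelow w g + g w + f x   ∎
  where open ≡-Reasoning

hasColour : Maybe ℕ → ℕ → ℕ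
hasColour nothing  r = 0
hasColour (just y) r = if y ≡ᵇ r then 1 else 0

hasColour-self : ∀ y → hasColour (just y) y ≡ 1
hasColour-self y with y ≡ᵇ y in eq
... | true  = refl
... | false = ⊥-elim (subst T eq (≡⇒≡ᵇ y y refl))

hasColour-other : ∀ {y r} → r ≢ y → hasColour (just y) r ≡ 0
hasColour-other {y} {r} r≢y with y ≡ᵇ r in eq
... | false = refl
... | true  = ⊥-elim (r≢y (sym (≡ᵇ⇒≡ y r (subst T (sym eq) _))))

hasColour-uncolour-self : ∀ x u → hasColour (uncolour x u) x ≡ 0
hasColour-uncolour-self x nothing  = refl
hasColour-uncolour-self x (just y) with x ≡ᵇ y in eq
... | true  = refl
... | false = hasColour-other λ x≡y → subst T eq (≡⇒≡ᵇ x y x≡y)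

hasColour-uncolour-other : ∀ {x r} u → r ≢ x → hasColour (uncolour x u) r ≡ hasColour u r
hasColour-uncolour-other         nothing  r≢x = refl
hasColour-uncolour-other {x} {r} (just y) r≢x with x ≡ᵇ y in eq
... | false = refl
... | true  = sym (hasColour-other λ r≡y → r≢x (trans r≡y (sym (≡ᵇ⇒≡ x y (subst T (sym eq) _)))))

classSize : PartialColouring n → ℕ → ℕ
classSize {zero}  c r = 0
classSize {suc n} c r = hasColour (c zero) r + classSize (tail c) r

classSize-removeColour-self : ∀ x (c : PartialColouring n) → classSize (removeColour x c) x ≡ 0
classSize-removeColour-self {zero}  x c = refl
classSize-removeColour-self {suc n} x c =
  cong₂ _+_ (hasColour-uncolour-self x (c zero)) (classSize-removeColour-self x (tail c))

classSize-removeColour-other : ∀ {x r} (c : PartialColouring n) → r ≢ x →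
                               classSize (removeColour x c) r ≡ classSize c r
classSize-removeColour-other {zero}  c r≢x = refl
classSize-removeColour-other {suc n} c r≢x =
  cong₂ _+_ (hasColour-uncolour-other (c zero) r≢x) (classSize-removeColour-other (tail c) r≢x)

ColoursBelow : ℕ → PartialColouring n → Set
ColoursBelow w c = ∀ i {y} → c i ≡ just y → y < w

ColoursBelow-removeColour : ∀ {c : PartialColouring n} → ColoursBelow w c → ColoursBelow w (removeColour x c)
ColoursBelow-removeColour {x = x} {c} below i = below i ∘ uncolour-just (c i)
  where
  uncolour-just : ∀ u {y} → uncolour x u ≡ just y → u ≡ just y
  uncolour-just (just z) eq with x ≡ᵇ z
  ... | false = eq

pairs singles : ℕ → (ℕ → ℕ) → ℕ
pairs   w μ = sumBelow w (λ r → ⌊ μ r /2⌋)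
singles w μ = sumBelow w (λ r → μ r % 2)

cliqueBound : ℕ → PartialColouring n → ℕ → ℕ
cliqueBound w c = cliques₂₁ (pairs w (classSize c)) (singles w (classSize c))

cliqueBound-uncoloured-head : ∀ (c : PartialColouring (suc n)) k → c zero ≡ nothing →
                              cliqueBound w (tail c) k ≡ cliqueBound w c k
cliqueBound-uncoloured-head {w = w} c k c₀≡nothing =
  cong₂ (λ p q → cliques₂₁ p q k) (sumBelow-cong w λ r _ → cong ⌊_/2⌋ (same r))
                                  (sumBelow-cong w λ r _ → cong (_% 2) (same r))
  where
  same : ∀ r → classSize (tail c) r ≡ classSize c r
  same r = cong (λ u → hasColour u r + classSize (tail c) r) (sym c₀≡nothing)

cliqueBound-grow : ∀ (c : PartialColouring (suc n)) k → x < w → c zero ≡ just x →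
  cliqueBound w (removeColour x (tail c)) k + cliqueBound w (tail c) (suc k) ≤ cliqueBound w c (suc k)
cliqueBound-grow {x = x} {w} c k x<w c₀≡x = begin
  cliques₂₁ P₀ Q₀ k + cliques₂₁ (pairs w μ) (singles w μ) (suc k)
    ≡⟨ cong₂ (λ p q → cliques₂₁ P₀ Q₀ k + cliques₂₁ p q (suc k)) (split ⌊_/2⌋ refl μ same) (split (_% 2) refl μ same) ⟩
  cliques₂₁ P₀ Q₀ k + cliques₂₁ (P₀ + ⌊ a /2⌋) (Q₀ + a % 2) (suc k)
    ≤⟨ cliques₂₁-grow P₀ Q₀ a k ⟩
  cliques₂₁ (P₀ + ⌊ suc a /2⌋) (Q₀ + suc a % 2) (suc k)
    ≡⟨ cong₂ (λ p q → cliques₂₁ p q (suc k)) (split⁺ ⌊_/2⌋ refl) (split⁺ (_% 2) refl) ⟨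
  cliques₂₁ (pairs w μ⁺) (singles w μ⁺) (suc k) ∎
  where
  open ≤-Reasoning
  μ₀ μ μ⁺ : ℕ → ℕ
  μ₀ = classSize (removeColour x (tail c))
  μ  = classSize (tail c)
  μ⁺ = classSize c
  a = μ x
  P₀ = pairs w μ₀
  Q₀ = singles w μ₀
  same : ∀ r → r ≢ x → μ r ≡ μ₀ r
  same r r≢x = sym (classSize-removeColour-other (tail c) r≢x)
  same⁺ : ∀ r → r ≢ x → μ⁺ r ≡ μ₀ r
  same⁺ r r≢x = trans (cong (λ u → hasColour u r + μ r) c₀≡x) (trans (cong (_+ μ r) (hasColour-other r≢x)) (same r r≢x))
  grown : μ⁺ x ≡ suc a
  grown = trans (cong (λ u → hasColour u x + a) c₀≡x) (cong (_+ a) (hasColour-self x))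
  split : ∀ (h : ℕ → ℕ) → h 0 ≡ 0 → ∀ ν → (∀ r → r ≢ x → ν r ≡ μ₀ r) →
          sumBelow w (h ∘ ν) ≡ sumBelow w (h ∘ μ₀) + h (ν x)
  split h h0≡0 ν ν≗μ₀ = sumBelow-split x<w
    (trans (cong h (classSize-removeColour-self x (tail c))) h0≡0) (λ r r≢x → cong h (ν≗μ₀ r r≢x))
  split⁺ : ∀ (h : ℕ → ℕ) → h 0 ≡ 0 → sumBelow w (h ∘ μ⁺) ≡ sumBelow w (h ∘ μ₀) + h (suc a)
  split⁺ h h0≡0 = trans (split h h0≡0 μ⁺ same⁺) (cong (λ b → sumBelow w (h ∘ μ₀) + h b) grown)

cliqueCount≤cliqueBound : ∀ (c : PartialColouring n) → ColoursBelow w c → ∀ k → cliqueCount c k ≤ cliqueBound w c k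
cliqueCount≤cliqueBound {zero}      c below zero    = ≤-refl
cliqueCount≤cliqueBound {zero}      c below (suc k) = z≤n
cliqueCount≤cliqueBound {suc n} {w} c below k       = ≤-trans (cliqueCount-suc c k) (bound k (c zero) refl)
  where
  tail-below : ColoursBelow w (tail c)
  tail-below i = below (suc i)
  bound : ∀ k u → c zero ≡ u → cliquesThrough₀ c k + cliqueCount (tail c) k ≤ cliqueBound w c k
  bound zero u _ rewrite cliquesThrough₀-zero c = cliqueCount≤cliqueBound (tail c) tail-below zero
  bound (suc k) nothing c₀≡nothing rewrite cliquesThrough₀-uncoloured c (suc k) c₀≡nothing =
    ≤-trans (cliqueCount≤cliqueBound (tail c) tail-below (suc k))
            (≤-reflexive (cliqueBound-uncoloured-head {w = w} c (suc k) c₀≡nothing))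
  bound (suc k) (just x) c₀≡x = begin
    cliquesThrough₀ c (suc k) + cliqueCount (tail c) (suc k)
      ≤⟨ +-monoˡ-≤ _ (cliquesThrough₀-coloured c k c₀≡x) ⟩
    cliqueCount (removeColour x (tail c)) k + cliqueCount (tail c) (suc k)
      ≤⟨ +-mono-≤ (cliqueCount≤cliqueBound _ (ColoursBelow-removeColour tail-below) k)
                  (cliqueCount≤cliqueBound (tail c) tail-below (suc k)) ⟩
    cliqueBound w (removeColour x (tail c)) k + cliqueBound w (tail c) (suc k)
      ≤⟨ cliqueBound-grow c k (below zero c₀≡x) c₀≡x ⟩
    cliqueBound w c (suc k) ∎
    where open ≤-Reasoning

sumBelow-hasColour≤1 : ∀ w u → (∀ {y} → u ≡ just y → y < w) → sumBelow w (hasColour u) ≤ 1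
sumBelow-hasColour≤1 w nothing  _     = ≤-trans (≤-reflexive (sumBelow-zero w)) z≤n
sumBelow-hasColour≤1 w (just y) below = ≤-reflexive (begin
  sumBelow w (hasColour (just y))
    ≡⟨ sumBelow-split {g = λ _ → 0} (below refl) refl (λ r → hasColour-other) ⟩
  sumBelow w (λ _ → 0) + hasColour (just y) y
    ≡⟨ cong₂ _+_ (sumBelow-zero w) (hasColour-self y) ⟩
  1 ∎)
  where open ≡-Reasoning

sumBelow-classSize≤ : ∀ (c : PartialColouring n) → ColoursBelow w c → sumBelow w (classSize c) ≤ n
sumBelow-classSize≤ {zero}  {w} c below = ≤-reflexive (sumBelow-zero w)
sumBelow-classSize≤ {suc n} {w} c below = begin
  sumBelow w (classSize c)
    ≡⟨ sumBelow-+ w (hasColour (c zero)) (classSize (tail c)) ⟩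
  sumBelow w (hasColour (c zero)) + sumBelow w (classSize (tail c))
    ≤⟨ +-mono-≤ (sumBelow-hasColour≤1 w (c zero) (below zero)) (sumBelow-classSize≤ (tail c) (below ∘ suc)) ⟩
  1 + n ∎
  where open ≤-Reasoning

2*[⌊n/2⌋+n%2]≤1+n : ∀ a → 2 * (⌊ a /2⌋ + a % 2) ≤ suc a
2*[⌊n/2⌋+n%2]≤1+n zero          = z≤n
2*[⌊n/2⌋+n%2]≤1+n (suc zero)    = ≤-refl
2*[⌊n/2⌋+n%2]≤1+n (suc (suc a)) =
  ≤-trans (≤-reflexive (*-suc 2 (⌊ a /2⌋ + a % 2))) (s≤s (s≤s (2*[⌊n/2⌋+n%2]≤1+n a)))

slots-bound : ∀ (c : PartialColouring n) → ColoursBelow w c →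
              2 * (pairs w (classSize c) + singles w (classSize c)) ≤ w + n
slots-bound {n} {w} c below = begin
  2 * (pairs w μ + singles w μ)                  ≡⟨ cong (2 *_) (sumBelow-+ w (⌊_/2⌋ ∘ μ) ((_% 2) ∘ μ)) ⟨
  2 * sumBelow w (λ r → ⌊ μ r /2⌋ + μ r % 2)     ≡⟨ sumBelow-*ˡ 2 w (λ r → ⌊ μ r /2⌋ + μ r % 2) ⟨
  sumBelow w (λ r → 2 * (⌊ μ r /2⌋ + μ r % 2))   ≤⟨ sumBelow-mono w (2*[⌊n/2⌋+n%2]≤1+n ∘ μ) ⟩
  sumBelow w (λ r → 1 + μ r)                     ≡⟨ sumBelow-+ w (λ _ → 1) μ ⟩
  sumBelow w (λ _ → 1) + sumBelow w μ            ≤⟨ +-mono-≤ (≤-reflexive (sumBelow-one w)) (sumBelow-classSize≤ c below) ⟩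
  w + n                                          ∎
  where
  open ≤-Reasoning
  μ = classSize c

turánColouring : (N ω : ℕ) → .{{NonZero ω}} → PartialColouring N
turánColouring N ω i = just (toℕ i % ω)

turánColouring-below : ∀ N ω .{{_ : NonZero ω}} → ColoursBelow ω (turánColouring N ω)
turánColouring-below N ω i refl = m%n<n (toℕ i) ω

turánCliques≤cliqueCount : ∀ N w k → turánCliques N (suc w) k ≤ cliqueCount (turánColouring N (suc w)) k
turánCliques≤cliqueCount N w k =
  count-∧-mono {p = λ S → ∣ S ∣ ≡ᵇ k} {q = isTuránClique N (suc w)} {r = isColourCliqueᵇ (turánColouring N (suc w))}
    (λ S clique → Equivalence.from T-∧ (clique , all⁻ _ (tabulate⁺ λ i → T-not-∨⁺ (lookup S i) true _)))
    (allSubsets N)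

turánOrder : ∀ t ω → ω ≤ t → ω + (2 * suc t ∸ ω ∸ 1) ≡ suc (2 * t)
turánOrder t ω ω≤t = begin
  ω + (2 * suc t ∸ ω ∸ 1)      ≡⟨ cong (ω +_) (∸-+-assoc (2 * suc t) ω 1) ⟩
  ω + (2 * suc t ∸ (ω + 1))    ≡⟨ cong (λ m → ω + (2 * suc t ∸ m)) (+-comm ω 1) ⟩
  ω + (2 * suc t ∸ suc ω)      ≡⟨ cong (λ m → ω + (m ∸ suc ω)) (*-suc 2 t) ⟩
  ω + (suc (2 * t) ∸ ω)        ≡⟨ m+[n∸m]≡n (m≤n⇒m≤1+n (≤-trans ω≤t (m≤n*m t 2))) ⟩
  suc (2 * t)                  ∎
  where open ≡-Reasoning

turánCliques≤ : ∀ {t w} k → suc w ≤ t → turánCliques (2 * suc t ∸ suc w ∸ 1) (suc w) k ≤ (t C k) * 2 ^ k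
turánCliques≤ {t} {w} k ω≤t = begin
  turánCliques N ω k          ≤⟨ turánCliques≤cliqueCount N w k ⟩
  cliqueCount c k             ≤⟨ cliqueCount≤cliqueBound c below k ⟩
  cliques₂₁ P Q k             ≤⟨ cliques₂₁≤ P Q k ⟩
  ((P + Q) C k) * 2 ^ k       ≤⟨ *-monoˡ-≤ (2 ^ k) (C-monoˡ k slots≤t) ⟩
  (t C k) * 2 ^ k             ∎
  where
  open ≤-Reasoning
  ω = suc w
  N = 2 * suc t ∸ ω ∸ 1
  c = turánColouring N ω
  below = turánColouring-below N ω
  P = pairs ω (classSize c)
  Q = singles ω (classSize c)
  slots≤t : P + Q ≤ t
  slots≤t = ≤-pred (*-cancelˡ-< 2 (P + Q) (suc t) (begin-strict
    2 * (P + Q)        ≤⟨ slots-bound c below ⟩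
    ω + N              ≡⟨ turánOrder t ω ω≤t ⟩
    suc (2 * t)        <⟨ n<1+n (suc (2 * t)) ⟩
    2 + 2 * t          ≡⟨ *-suc 2 t ⟨
    2 * suc t          ∎))

Cstar≤ : ∀ {t k B} → k ≤ t → (∀ ω → k ≤ ω → ω < t → turánCliques (2 * t ∸ ω ∸ 1) ω k ≤ B) → Cstar t k ≤ B
Cstar≤ {t} {k} {B} k≤t bound = foldr-preservesᵇ {P = _≤ B} ⊔-lub z≤n (map⁺ (map⁺ (applyUpTo⁺₁ id (t ∸ k) λ {i} i<t∸k →
  bound (k + i) (m≤m+n k i) (begin-strict
    k + i        <⟨ +-monoʳ-< k i<t∸k ⟩
    k + (t ∸ k)  ≡⟨ m+[n∸m]≡n k≤t ⟩
    t            ∎))))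
  where open ≤-Reasoning

claimA1 : (k t : ℕ) → 1 ≤ k → k < t → Cstar t k ≤ ((t ∸ 1) C k) * 2 ^ k
claimA1 k (suc t) 1≤k k<t = Cstar≤ (<⇒≤ k<t) bound
  where
  bound : ∀ ω → k ≤ ω → ω < suc t → turánCliques (2 * suc t ∸ ω ∸ 1) ω k ≤ (t C k) * 2 ^ k
  bound zero    k≤0 _   with () ← ≤-trans 1≤k k≤0
  bound (suc w) _   ω<t = turánCliques≤ k (≤-pred ω<t)
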